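{- Let $G$ be a cubic negative Lehman graph, and let $\mathcal{P}$ be a partition of $V(G)$ into blocks each inducing a copy of $K_{2,2}$. If $G$ is not (isomorphic to) the graph obtained from $K_{4,4}$ by removing a perfect matching, then $c(G,\mathcal{P})$ is cubic.
   Context: A bipartite graph $G$ with $n$ black and $n$ white vertices has bipartite adjacency matrix $A$ (rows indexed by black vertices, columns by white vertices, entry $1$ iff adjacent). $G$ is a cubic negative Lehman graph if $G$ is $3$-regular and there is an $n\times n$ $(0,1)$-matrix $B$ with $AB^T=J-I$, $J$ the all-ones matrix and $I$ the identity. Given such a partition $\mathcal{P}$ (each block has $2$ black and $2$ white vertices), the compressed graph $c(G,\mathcal{P})$ is the simple bipartite graph with one black vertex $b_X$ and one white vertex $w_X$ for each block $X\in\mathcal{P}$, where $b_X$ is adjacent to $w_Y$ iff $X=Y$ or some black vertex of $X$ is adjacent in $G$ to some white vertex of $Y$. -}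

module Defs where

open import Data.Nat using (ℕ; zero; suc)
open import Data.Bool using (Bool; true; false; _∧_; _∨_; if_then_else_)
open import Data.Fin using (Fin; zero; suc)
open import Data.Fin.Properties using (_≟_)
open import Data.Sum using (_⊎_; inj₁; inj₂)
open import Relation.Nullary.Decidable using (⌊_⌋)
open import Relation.Binary.PropositionalEquality using (_≡_)
open import Function.Bundles using (_↔_; Inverse)

-- Bipartite (0,1)-matrices: rows = black vertices, columns = white vertices.
Matrix : ℕ → Set
Matrix n = Fin n → Fin n → Bool

count : ∀ {n} → (Fin n → Bool) → ℕ
count {zero} p = 0
count {suc n} p = (if p zero then 1 else 0) Data.Nat.+ count (λ k → p (suc k))

anyFin : ∀ {n} → (Fin n → Bool) → Bool
anyFin {zero} p = false
anyFin {suc n} p = p zero ∨ anyFin (λ k → p (suc k))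

_==_ : ∀ {n} → Fin n → Fin n → Bool
i == j = ⌊ i ≟ j ⌋

Cubic : ∀ {n} → Matrix n → Set
Cubic {n} A = (∀ b → count (λ w → A b w) ≡ 3) Data.Product.× (∀ w → count (λ b → A b w) ≡ 3)
  where import Data.Product

-- A B^T = J - I  over (0,1)-matrices
NegativeLehman : ∀ {n} → Matrix n → Set
NegativeLehman {n} A = Data.Product.Σ (Matrix n) λ B →
  ∀ i j → count (λ k → A i k ∧ B j k) ≡ (if i == j then 0 else 1)
  where import Data.Product

CubicNegativeLehman : ∀ {n} → Matrix n → Set
CubicNegativeLehman A = Cubic A Data.Product.× NegativeLehman A
  where import Data.Product

-- A partition of V(G) into m blocks, given by the block of each black and of
-- each white vertex; every block contains exactly 2 black and 2 white vertices
-- and induces K_{2,2} (all four black-white edges inside a block are present).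
record K22Partition {n : ℕ} (A : Matrix n) (m : ℕ) : Set where
  field
    blackBlock : Fin n → Fin m
    whiteBlock : Fin n → Fin m
    twoBlack   : ∀ X → count (λ b → blackBlock b == X) ≡ 2
    twoWhite   : ∀ X → count (λ w → whiteBlock w == X) ≡ 2
    complete   : ∀ b w → blackBlock b ≡ whiteBlock w → A b w ≡ true

compress : ∀ {n m} {A : Matrix n} → K22Partition A m → Matrix m
compress {A = A} P X Y =
  (X == Y) ∨ anyFin (λ b → anyFin (λ w →
     (blackBlock b == X) ∧ (whiteBlock w == Y) ∧ A b w))
  where open K22Partition P

Vertex : ℕ → Set
Vertex n = Fin n ⊎ Fin n

adj : ∀ {n} → Matrix n → Vertex n → Vertex n → Bool
adj A (inj₁ b) (inj₂ w) = A b w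
adj A (inj₂ w) (inj₁ b) = A b w
adj A (inj₁ _) (inj₁ _) = false
adj A (inj₂ _) (inj₂ _) = false

Isomorphic : ∀ {n k} → Matrix n → Matrix k → Set
Isomorphic {n} {k} A C = Data.Product.Σ (Vertex n ↔ Vertex k) λ f →
  ∀ u v → adj C (Inverse.to f u) (Inverse.to f v) ≡ adj A u v
  where import Data.Product

K44minusM : Matrix 4
K44minusM i j = if i == j then false else true

-- Every black vertex b of a block X has exactly one neighbour outside X, so row X of c(G,P)
-- consists of X and the blocks of the outside neighbours w₁, w₂ of the two blacks b₁, b₂ of X.
-- Two blacks of one block cannot share their outside neighbour (its column would contain four
-- ones), so the row has three ones unless w₁ and w₂ lie in a common block Y: X and Y are then
-- doubly linked. This configuration is symmetric in the two colours, which settles the columns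
-- by transposition.
--
-- Doubly linked blocks force n = 4. Let x₁, x₂ be the whites of X, y₁, y₂ the blacks of Y and
-- z₁, z₂ the outside neighbours of y₁, y₂. Reading A Bᵀ = J − I on the neighbourhoods
-- {x₁, x₂, w₁}, {x₁, x₂, w₂} of b₁, b₂ and {w₁, w₂, zᵢ} of yᵢ shows that every row j of B with
-- j ∉ {b₁, b₂, y₁, y₂} vanishes on w₁, w₂ and is 1 on z₁, z₂. The zero diagonal of A Bᵀ then
-- confines the neighbours of z₁, z₂ to {b₁, b₂, y₁, y₂}, whence {z₁, z₂} = {x₁, x₂} (z₁ ≠ z₂ by
-- comparing the rows y₁ and y₂ against B y₁), and row j of B would meet the neighbourhood of b₁
-- twice. Hence n = 4, and a cubic graph on 4 + 4 vertices is K₄,₄ minus a perfect matching.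

module Submission where

open import Defs
open import Data.Bool using (Bool; true; false; not; _∧_; _∨_; if_then_else_)
open import Data.Bool.Properties
  using (∧-zeroʳ; ∧-identityʳ; ∨-zeroʳ; ¬-not; not-injective; ⇔→≡)
open import Data.Empty using (⊥; ⊥-elim)
open import Data.Fin using (Fin; zero; suc)
open import Data.Fin.Properties using (_≟_; suc-injective)
open import Data.List using (List; []; _∷_; length; map)
open import Data.List.Membership.Propositional using (_∈_; _∉_)
open import Data.List.Relation.Unary.All using (All; []; _∷_)
import Data.List.Relation.Unary.All as All
open import Data.List.Relation.Unary.Any using (here; there; any?)
open import Data.List.Relation.Unary.Unique.Propositional using (Unique; []; _∷_)
open import Data.Nat using (ℕ; zero; suc; _+_; _≤_; _<_; s≤s; z≤n)
open import Data.Nat.ListAction using (sum)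
open import Data.Nat.Properties
  using (+-assoc; +-suc; +-identityʳ; +-cancelˡ-≡; ≤-refl; m≤m+n; m+n≡0⇒m≡0; m+n≡0⇒n≡0; <⇒≢;
         +-commutativeSemigroup)
open import Algebra.Properties.CommutativeSemigroup +-commutativeSemigroup using (x∙yz≈y∙xz)
open import Data.Product using (∃; ∃₂; _×_; _,_; proj₁; proj₂; swap)
open import Data.Sum using (_⊎_; inj₁; inj₂)
open import Function using (_∘_)
open import Function.Bundles using (mk⇔; mk↔ₛ′)
open import Relation.Nullary using (¬_; yes; no; contradiction)
open import Relation.Nullary.Decidable using (⌊⌋-map′)
open import Relation.Binary.PropositionalEquality
  using (_≡_; _≢_; refl; sym; trans; cong; cong₂; subst; ≢-sym; module ≡-Reasoning)

-- count {suc n} p unfolds definitionally to bit (p zero) + count (p ∘ suc).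
bit : Bool → ℕ
bit b = if b then 1 else 0

bit-injective : ∀ {a b} → bit a ≡ bit b → a ≡ b
bit-injective {false} {false} _ = refl
bit-injective {true}  {true}  _ = refl

∧-elim : ∀ {a b} → a ∧ b ≡ true → a ≡ true × b ≡ true
∧-elim {true} b≡true = refl , b≡true

∧-intro : ∀ {a b} → a ≡ true → b ≡ true → a ∧ b ≡ true
∧-intro refl b≡true = b≡true

∨-elim : ∀ {a b} → a ∨ b ≡ true → a ≡ true ⊎ b ≡ true
∨-elim {true}  _ = inj₁ refl
∨-elim {false} e = inj₂ e

≡⇒== : ∀ {n} {i j : Fin n} → i ≡ j → (i == j) ≡ true
≡⇒== {i = i} {j} i≡j with i ≟ j
... | yes _   = refl
... | no i≢j = contradiction i≡j i≢j

==-refl : ∀ {n} (i : Fin n) → (i == i) ≡ true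
==-refl i = ≡⇒== refl

≢⇒== : ∀ {n} {i j : Fin n} → i ≢ j → (i == j) ≡ false
≢⇒== {i = i} {j} i≢j with i ≟ j
... | yes i≡j = contradiction i≡j i≢j
... | no _    = refl

==⇒≡ : ∀ {n} {i j : Fin n} → (i == j) ≡ true → i ≡ j
==⇒≡ {i = i} {j} e with i ≟ j
... | yes i≡j = i≡j

==-suc : ∀ {n} (i j : Fin n) → (suc i == suc j) ≡ (i == j)
==-suc i j = ⌊⌋-map′ (cong suc) suc-injective (i ≟ j)

anyFin-intro : ∀ {n} (p : Fin n → Bool) (k : Fin n) → p k ≡ true → anyFin p ≡ true
anyFin-intro p zero    pk rewrite pk = refl
anyFin-intro p (suc k) pk = trans (cong (p zero ∨_) (anyFin-intro (p ∘ suc) k pk)) (∨-zeroʳ (p zero))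

anyFin-elim : ∀ {n} (p : Fin n → Bool) → anyFin p ≡ true → ∃ λ k → p k ≡ true
anyFin-elim {suc n} p e with p zero in eq
... | true  = zero , eq
... | false with anyFin-elim (p ∘ suc) e
...   | k , pk = suc k , pk

-- Counting

count-cong : ∀ {n} {p q : Fin n → Bool} → (∀ k → p k ≡ q k) → count p ≡ count q
count-cong {zero}  p≗q = refl
count-cong {suc n} p≗q = cong₂ _+_ (cong bit (p≗q zero)) (count-cong (p≗q ∘ suc))

count-true : ∀ {n} → count {n} (λ _ → true) ≡ n
count-true {zero}  = refl
count-true {suc n} = cong suc (count-true {n})

count-false : ∀ {n} {p : Fin n → Bool} → (∀ k → p k ≡ false) → count p ≡ 0
count-false {zero}  p≗false = refl
count-false {suc n} p≗false rewrite p≗false zero = count-false (p≗false ∘ suc)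

count≡0⇒false : ∀ {n} {p : Fin n → Bool} → count p ≡ 0 → ∀ k → p k ≡ false
count≡0⇒false {p = p} c zero    = bit≡0 (m+n≡0⇒m≡0 (bit (p zero)) c)
  where
  bit≡0 : ∀ {b} → bit b ≡ 0 → b ≡ false
  bit≡0 {false} _ = refl
count≡0⇒false {p = p} c (suc k) = count≡0⇒false (m+n≡0⇒n≡0 (bit (p zero)) c) k

count≢0⇒∃ : ∀ {n} (p : Fin n → Bool) → count p ≢ 0 → ∃ λ k → p k ≡ true
count≢0⇒∃ {zero}  p c = contradiction refl c
count≢0⇒∃ {suc n} p c with p zero in eq
... | true  = zero , eq
... | false with count≢0⇒∃ (p ∘ suc) c
...   | k , pk = suc k , pk

count-not : ∀ {n} (p : Fin n → Bool) → count p + count (not ∘ p) ≡ n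
count-not {zero}  p = refl
count-not {suc n} p with p zero
... | true  = cong suc (count-not (p ∘ suc))
... | false = trans (+-suc (count (p ∘ suc)) _) (cong suc (count-not (p ∘ suc)))

_∖_ : ∀ {n} → (Fin n → Bool) → Fin n → Fin n → Bool
(p ∖ a) k = p k ∧ not (k == a)

_∖∖_ : ∀ {n} → (Fin n → Bool) → List (Fin n) → Fin n → Bool
p ∖∖ []       = p
p ∖∖ (a ∷ ks) = (p ∖ a) ∖∖ ks

count-∖ : ∀ {n} (p : Fin n → Bool) (a : Fin n) → count p ≡ bit (p a) + count (p ∖ a)
count-∖ p zero rewrite ∧-zeroʳ (p zero) =
  cong (bit (p zero) +_) (count-cong λ k → sym (∧-identityʳ (p (suc k))))
count-∖ p (suc a) = begin
  bit (p zero) + count (p ∘ suc)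
    ≡⟨ cong (bit (p zero) +_) (count-∖ (p ∘ suc) a) ⟩
  bit (p zero) + (bit (p (suc a)) + count ((p ∘ suc) ∖ a))
    ≡⟨ x∙yz≈y∙xz (bit (p zero)) (bit (p (suc a))) _ ⟩
  bit (p (suc a)) + (bit (p zero) + count ((p ∘ suc) ∖ a))
    ≡⟨ cong (bit (p (suc a)) +_) (cong₂ _+_ head tail) ⟩
  bit (p (suc a)) + count (p ∖ suc a)
    ∎
  where
  open ≡-Reasoning
  head : bit (p zero) ≡ bit (p zero ∧ true)
  head = cong bit (sym (∧-identityʳ (p zero)))
  tail : count ((p ∘ suc) ∖ a) ≡ count ((p ∖ suc a) ∘ suc)
  tail = count-cong λ k → cong (λ b → p (suc k) ∧ not b) (sym (==-suc k a))

module _ {n : ℕ} where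

  ∖-≢ : (p : Fin n → Bool) {a k : Fin n} → k ≢ a → (p ∖ a) k ≡ p k
  ∖-≢ p {a} {k} k≢a rewrite ≢⇒== k≢a = ∧-identityʳ (p k)

  ∖-true : (p : Fin n → Bool) {a k : Fin n} → (p ∖ a) k ≡ true → p k ≡ true × k ≢ a
  ∖-true p {a} {k} e = proj₁ (∧-elim e) , λ { refl → not-refl (proj₂ (∧-elim {p k} e)) }
    where
    not-refl : not (k == k) ≢ true
    not-refl e rewrite ==-refl k = contradiction e λ ()

  ∖∖-∉ : (p : Fin n → Bool) (ks : List (Fin n)) {k : Fin n} → k ∉ ks → (p ∖∖ ks) k ≡ p k
  ∖∖-∉ p []       k∉ks = refl
  ∖∖-∉ p (a ∷ ks) k∉ks = trans (∖∖-∉ (p ∖ a) ks (k∉ks ∘ there)) (∖-≢ p (k∉ks ∘ here))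

  ∖∖-true : (p : Fin n → Bool) (ks : List (Fin n)) {k : Fin n} →
            (p ∖∖ ks) k ≡ true → p k ≡ true × k ∉ ks
  ∖∖-true p []       e = e , λ ()
  ∖∖-true p (a ∷ ks) e with ∖∖-true (p ∖ a) ks e
  ... | p∖a-k , k∉ks with ∖-true p p∖a-k
  ...   | pk , k≢a = pk , λ { (here k≡a) → k≢a k≡a ; (there k∈ks) → k∉ks k∈ks }

  sum-map-cong : {f g : Fin n → ℕ} {ks : List (Fin n)} →
                 All (λ k → f k ≡ g k) ks → sum (map f ks) ≡ sum (map g ks)
  sum-map-cong []           = refl
  sum-map-cong (fk≡gk ∷ es) = cong₂ _+_ fk≡gk (sum-map-cong es)

  sum-bits-true : {p : Fin n → Bool} {ks : List (Fin n)} →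
                  All (λ k → p k ≡ true) ks → sum (map (bit ∘ p) ks) ≡ length ks
  sum-bits-true []       = refl
  sum-bits-true (pk ∷ t) = cong₂ _+_ (cong bit pk) (sum-bits-true t)

  count-∖∖ : (p : Fin n → Bool) {ks : List (Fin n)} → Unique ks →
             count p ≡ sum (map (bit ∘ p) ks) + count (p ∖∖ ks)
  count-∖∖ p []                     = refl
  count-∖∖ p {a ∷ ks} (a∉ks ∷ uniq) = begin
    count p
      ≡⟨ count-∖ p a ⟩
    bit (p a) + count (p ∖ a)
      ≡⟨ cong (bit (p a) +_) (count-∖∖ (p ∖ a) uniq) ⟩
    bit (p a) + (sum (map (bit ∘ (p ∖ a)) ks) + count (p ∖∖ (a ∷ ks)))
      ≡⟨ cong (λ s → bit (p a) + (s + count (p ∖∖ (a ∷ ks)))) (sum-map-cong agree) ⟩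
    bit (p a) + (sum (map (bit ∘ p) ks) + count (p ∖∖ (a ∷ ks)))
      ≡⟨ +-assoc (bit (p a)) _ _ ⟨
    sum (map (bit ∘ p) (a ∷ ks)) + count (p ∖∖ (a ∷ ks))
      ∎
    where
    open ≡-Reasoning
    agree : All (λ k → bit ((p ∖ a) k) ≡ bit (p k)) ks
    agree = All.map (λ a≢k → cong bit (∖-≢ p (≢-sym a≢k))) a∉ks

  count-over : (p : Fin n → Bool) {ks : List (Fin n)} → Unique ks →
               (∀ {k} → p k ≡ true → k ∈ ks) → count p ≡ sum (map (bit ∘ p) ks)
  count-over p {ks} uniq covers = begin
    count p                                   ≡⟨ count-∖∖ p uniq ⟩
    sum (map (bit ∘ p) ks) + count (p ∖∖ ks)  ≡⟨ cong (sum (map (bit ∘ p) ks) +_) rest≡0 ⟩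
    sum (map (bit ∘ p) ks) + 0                ≡⟨ +-identityʳ _ ⟩
    sum (map (bit ∘ p) ks)                    ∎
    where
    open ≡-Reasoning
    rest≡0 : count (p ∖∖ ks) ≡ 0
    rest≡0 = count-false {p = p ∖∖ ks} λ k → ¬-not λ e → let pk , k∉ks = ∖∖-true p ks e in k∉ks (covers pk)

  module _ {p : Fin n → Bool} {ks : List (Fin n)}
           (uniq : Unique ks) (true-on : All (λ k → p k ≡ true) ks) where

    count-split : count p ≡ length ks + count (p ∖∖ ks)
    count-split = trans (count-∖∖ p uniq) (cong (_+ count (p ∖∖ ks)) (sum-bits-true true-on))

    length≤count : length ks ≤ count p
    length≤count = subst (length ks ≤_) (sym count-split) (m≤m+n _ _)

    count≡length⇒⊆ : count p ≡ length ks → ∀ {k} → p k ≡ true → k ∈ ks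
    count≡length⇒⊆ c {k} pk with any? (k ≟_) ks
    ... | yes k∈ks = k∈ks
    ... | no  k∉ks =
      contradiction (trans (sym (count≡0⇒false rest≡0 k)) (trans (∖∖-∉ p ks k∉ks) pk)) λ ()
      where
      rest≡0 : count (p ∖∖ ks) ≡ 0
      rest≡0 = +-cancelˡ-≡ (length ks) _ _ (trans (sym count-split) (trans c (sym (+-identityʳ _))))

    length<count⇒∃ : length ks < count p → ∃ λ k → p k ≡ true × k ∉ ks
    length<count⇒∃ lt = let k , e = count≢0⇒∃ (p ∖∖ ks) rest≢0 in k , ∖∖-true p ks e
      where
      rest≢0 : count (p ∖∖ ks) ≢ 0
      rest≢0 r≡0 = <⇒≢ lt (sym (trans count-split (trans (cong (length ks +_) r≡0) (+-identityʳ _))))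

    count-exactly : (∀ {k} → p k ≡ true → k ∈ ks) → count p ≡ length ks
    count-exactly covers = trans (count-over p uniq covers) (sum-bits-true true-on)

    count-∧ : count p ≡ length ks → (q : Fin n → Bool) →
              count (λ k → p k ∧ q k) ≡ sum (map (bit ∘ q) ks)
    count-∧ c q = trans (count-over (λ k → p k ∧ q k) uniq (count≡length⇒⊆ c ∘ proj₁ ∘ ∧-elim))
                        (sum-map-cong (All.map (λ pk → cong (λ b → bit (b ∧ q _)) pk) true-on))

count≡1⇒unique : ∀ {n} (p : Fin n → Bool) → count p ≡ 1 →
                 ∃ λ a → p a ≡ true × ∀ {k} → p k ≡ true → k ≡ a
count≡1⇒unique p c with length<count⇒∃ [] [] (subst (0 <_) (sym c) (s≤s z≤n))
... | a , pa , _ = a , pa , λ pk → singleton (count≡length⇒⊆ ([] ∷ []) (pa ∷ []) c pk)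
  where
  singleton : ∀ {k} → k ∈ a ∷ [] → k ≡ a
  singleton (here k≡a) = k≡a

module _ {a} {A : Set a} where

  unique-snoc₂ : ∀ {x y z : A} → x ≢ y → z ∉ x ∷ y ∷ [] → Unique (x ∷ y ∷ z ∷ [])
  unique-snoc₂ x≢y z∉xy =
    (x≢y ∷ (z∉xy ∘ here ∘ sym) ∷ []) ∷ ((z∉xy ∘ there ∘ here ∘ sym) ∷ []) ∷ [] ∷ []

  pair-exhausted : ∀ {x y u v : A} {P : A → Set} → u ≢ v → u ∈ x ∷ y ∷ [] → v ∈ x ∷ y ∷ [] →
                   P u → P v → P x × P y
  pair-exhausted u≢v (here refl)         (here refl)         _  _  = contradiction refl u≢v
  pair-exhausted u≢v (here refl)         (there (here refl)) Pu Pv = Pu , Pv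
  pair-exhausted u≢v (there (here refl)) (here refl)         Pu Pv = Pv , Pu
  pair-exhausted u≢v (there (here refl)) (there (here refl)) _  _  = contradiction refl u≢v

-- Blocks of a K₂,₂-partition

record BlockPair {n m : ℕ} (f : Fin n → Fin m) (X : Fin m) : Set where
  field
    fst snd : Fin n
    fst≢snd : fst ≢ snd
    fst∈X   : f fst ≡ X
    snd∈X   : f snd ≡ X
    only    : ∀ {v} → f v ≡ X → v ∈ fst ∷ snd ∷ []

blockPair : ∀ {n m} (f : Fin n → Fin m) (X : Fin m) → count (λ v → f v == X) ≡ 2 → BlockPair f X
blockPair f X c with length<count⇒∃ [] [] (subst (0 <_) (sym c) (s≤s z≤n))
... | a , fa , _ with length<count⇒∃ ([] ∷ []) (fa ∷ []) (subst (1 <_) (sym c) (s≤s (s≤s z≤n)))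
...   | b , fb , b∉a = record
  { fst = a ; snd = b ; fst≢snd = a≢b ; fst∈X = ==⇒≡ fa ; snd∈X = ==⇒≡ fb
  ; only = count≡length⇒⊆ ((a≢b ∷ []) ∷ [] ∷ []) (fa ∷ fb ∷ []) c ∘ ≡⇒== }
  where
  a≢b : a ≢ b
  a≢b = b∉a ∘ here ∘ sym

unique-across-blocks : ∀ {n m} {f : Fin n → Fin m} {X Y : Fin m} {a₁ a₂ c₁ c₂ : Fin n} →
  X ≢ Y → a₁ ≢ a₂ → c₁ ≢ c₂ → f a₁ ≡ X → f a₂ ≡ X → f c₁ ≡ Y → f c₂ ≡ Y →
  Unique (a₁ ∷ a₂ ∷ c₁ ∷ c₂ ∷ [])
unique-across-blocks {f = f} {X} {Y} X≢Y a₁≢a₂ c₁≢c₂ a₁∈X a₂∈X c₁∈Y c₂∈Y =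
  (a₁≢a₂ ∷ apart a₁∈X c₁∈Y ∷ apart a₁∈X c₂∈Y ∷ []) ∷
  (apart a₂∈X c₁∈Y ∷ apart a₂∈X c₂∈Y ∷ []) ∷ (c₁≢c₂ ∷ []) ∷ [] ∷ []
  where
  apart : ∀ {a c} → f a ≡ X → f c ≡ Y → a ≢ c
  apart a∈X c∈Y refl = X≢Y (trans (sym a∈X) c∈Y)

record DoublyLinked {n m : ℕ} {A : Matrix n} (P : K22Partition A m) : Set where
  open K22Partition P
  field
    b₁ b₂ w₁ w₂      : Fin n
    b₁≢b₂            : b₁ ≢ b₂
    w₁≢w₂            : w₁ ≢ w₂
    same-black-block : blackBlock b₁ ≡ blackBlock b₂
    same-white-block : whiteBlock w₁ ≡ whiteBlock w₂
    distinct-blocks  : blackBlock b₁ ≢ whiteBlock w₁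
    edge₁            : A b₁ w₁ ≡ true
    edge₂            : A b₂ w₂ ≡ true

module K22Blocks {n m : ℕ} {A : Matrix n} (P : K22Partition A m) where

  open K22Partition P

  blacksOf : ∀ X → BlockPair blackBlock X
  blacksOf X = blockPair blackBlock X (twoBlack X)

  whitesOf : ∀ X → BlockPair whiteBlock X
  whitesOf X = blockPair whiteBlock X (twoWhite X)

  compress-refl : ∀ X → compress P X X ≡ true
  compress-refl X rewrite ==-refl X = refl

  compress-edge : ∀ {b w} → A b w ≡ true → compress P (blackBlock b) (whiteBlock w) ≡ true
  compress-edge {b} {w} bw =
    trans (cong (blackBlock b == whiteBlock w ∨_) (anyFin-intro _ b (anyFin-intro _ w
            (∧-intro (==-refl (blackBlock b)) (∧-intro (==-refl (whiteBlock w)) bw)))))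
          (∨-zeroʳ _)

  compress-elim : ∀ {X Y} → compress P X Y ≡ true →
    X ≡ Y ⊎ ∃₂ λ b w → blackBlock b ≡ X × whiteBlock w ≡ Y × A b w ≡ true
  compress-elim {X} {Y} e with ∨-elim {X == Y} e
  ... | inj₁ X==Y = inj₁ (==⇒≡ X==Y)
  ... | inj₂ linked with anyFin-elim _ linked
  ...   | b , linked-b with anyFin-elim _ linked-b
  ...     | w , e′ with ∧-elim {blackBlock b == X} e′
  ...       | b∈X , e″ with ∧-elim {whiteBlock w == Y} e″
  ...         | w∈Y , bw = inj₂ (b , w , ==⇒≡ b∈X , ==⇒≡ w∈Y , bw)

  record OutsideNeighbour (b : Fin n) : Set where
    field
      vertex  : Fin n
      edge    : A b vertex ≡ true
      outside : whiteBlock vertex ≢ blackBlock b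
      only    : ∀ {v} → A b v ≡ true → whiteBlock v ≡ blackBlock b ⊎ v ≡ vertex

  module _ (rows : ∀ b → count (A b) ≡ 3) (b : Fin n) where

    open BlockPair (whitesOf (blackBlock b)) renaming (fst to x₁; snd to x₂; fst≢snd to x₁≢x₂)

    private
      bx₁ : A b x₁ ≡ true
      bx₁ = complete b x₁ (sym fst∈X)
      bx₂ : A b x₂ ≡ true
      bx₂ = complete b x₂ (sym snd∈X)

    outsideNeighbour : OutsideNeighbour b
    outsideNeighbour =
      fromThird (length<count⇒∃ uniq-x (bx₁ ∷ bx₂ ∷ []) (subst (2 <_) (sym (rows b)) ≤-refl))
      where
      uniq-x : Unique (x₁ ∷ x₂ ∷ [])
      uniq-x = (x₁≢x₂ ∷ []) ∷ [] ∷ []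
      fromThird : (∃ λ w → A b w ≡ true × w ∉ x₁ ∷ x₂ ∷ []) → OutsideNeighbour b
      fromThird (w , bw , w∉x) = record
        { vertex  = w
        ; edge    = bw
        ; outside = λ w∈X → w∉x (only w∈X)
        ; only    = λ bv →
            classify (count≡length⇒⊆ (unique-snoc₂ x₁≢x₂ w∉x) (bx₁ ∷ bx₂ ∷ bw ∷ []) (rows b) bv) }
        where
        classify : ∀ {v} → v ∈ x₁ ∷ x₂ ∷ w ∷ [] → whiteBlock v ≡ blackBlock b ⊎ v ≡ w
        classify (here refl)                = inj₁ fst∈X
        classify (there (here refl))        = inj₁ snd∈X
        classify (there (there (here v≡w))) = inj₂ v≡w

  common-neighbour-in-block : (∀ w → count (λ b → A b w) ≡ 3) → ∀ {b₁ b₂ w} →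
    b₁ ≢ b₂ → blackBlock b₁ ≡ blackBlock b₂ → A b₁ w ≡ true → A b₂ w ≡ true →
    whiteBlock w ≡ blackBlock b₁
  common-neighbour-in-block cols {b₁} {b₂} {w} b₁≢b₂ same b₁w b₂w with whiteBlock w ≟ blackBlock b₁
  ... | yes w∈X = w∈X
  ... | no  w∉X =
    contradiction (subst (4 ≤_) (cols w) (length≤count uniq (b₁w ∷ b₂w ∷ y₁w ∷ y₂w ∷ [])))
                  λ { (s≤s (s≤s (s≤s ()))) }
    where
    open BlockPair (blacksOf (whiteBlock w)) renaming (fst to y₁; snd to y₂)
    uniq : Unique (b₁ ∷ b₂ ∷ y₁ ∷ y₂ ∷ [])
    uniq = unique-across-blocks (w∉X ∘ sym) b₁≢b₂ fst≢snd refl (sym same) fst∈X snd∈X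
    y₁w : A y₁ w ≡ true
    y₁w = complete y₁ w fst∈X
    y₂w : A y₂ w ≡ true
    y₂w = complete y₂ w snd∈X

  module _ (cols : ∀ w → count (λ b → A b w) ≡ 3) (unlinked : ¬ DoublyLinked P) {X : Fin m}
           (blacks : BlockPair blackBlock X)
           (n₁ : OutsideNeighbour (BlockPair.fst blacks))
           (n₂ : OutsideNeighbour (BlockPair.snd blacks)) where

    private
      module Bs = BlockPair blacks
      module N₁ = OutsideNeighbour n₁
      module N₂ = OutsideNeighbour n₂
      Y₁ : Fin m
      Y₁ = whiteBlock N₁.vertex
      Y₂ : Fin m
      Y₂ = whiteBlock N₂.vertex

      linked : ∀ {b} (N : OutsideNeighbour b) → blackBlock b ≡ X →
               compress P X (whiteBlock (OutsideNeighbour.vertex N)) ≡ true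
      linked N refl = compress-edge (OutsideNeighbour.edge N)

      via : ∀ {b} (N : OutsideNeighbour b) → blackBlock b ≡ X → ∀ {w Y} → whiteBlock w ≡ Y →
            A b w ≡ true → Y ∈ X ∷ whiteBlock (OutsideNeighbour.vertex N) ∷ []
      via N refl refl bw with OutsideNeighbour.only N bw
      ... | inj₁ w∈X  = here w∈X
      ... | inj₂ refl = there (here refl)

      covers : ∀ {Y} → compress P X Y ≡ true → Y ∈ X ∷ Y₁ ∷ Y₂ ∷ []
      covers e with compress-elim e
      ... | inj₁ refl = here refl
      ... | inj₂ (b , w , b∈X , w∈Y , bw) with Bs.only b∈X
      ...   | here refl with via n₁ b∈X w∈Y bw
      ...     | here Y≡X          = here Y≡X
      ...     | there (here Y≡Y₁) = there (here Y≡Y₁)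
      covers e | inj₂ (b , w , b∈X , w∈Y , bw) | there (here refl) with via n₂ b∈X w∈Y bw
      ...     | here Y≡X          = here Y≡X
      ...     | there (here Y≡Y₂) = there (there (here Y≡Y₂))

      same-black-block : blackBlock Bs.fst ≡ blackBlock Bs.snd
      same-black-block = trans Bs.fst∈X (sym Bs.snd∈X)

      w₁≢w₂ : N₁.vertex ≢ N₂.vertex
      w₁≢w₂ w₁≡w₂ = N₁.outside (common-neighbour-in-block cols Bs.fst≢snd same-black-block
                                  N₁.edge (subst (λ w → A Bs.snd w ≡ true) (sym w₁≡w₂) N₂.edge))

      Y₁≢Y₂ : Y₁ ≢ Y₂
      Y₁≢Y₂ Y₁≡Y₂ = unlinked record
        { b₁ = Bs.fst ; b₂ = Bs.snd ; w₁ = N₁.vertex ; w₂ = N₂.vertex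
        ; b₁≢b₂ = Bs.fst≢snd ; w₁≢w₂ = w₁≢w₂
        ; same-black-block = same-black-block ; same-white-block = Y₁≡Y₂
        ; distinct-blocks = ≢-sym N₁.outside ; edge₁ = N₁.edge ; edge₂ = N₂.edge }

      uniq : Unique (X ∷ Y₁ ∷ Y₂ ∷ [])
      uniq = (≢-sym (subst (Y₁ ≢_) Bs.fst∈X N₁.outside) ∷ ≢-sym (subst (Y₂ ≢_) Bs.snd∈X N₂.outside) ∷ [])
             ∷ (Y₁≢Y₂ ∷ []) ∷ [] ∷ []

    block-row-degree : count (compress P X) ≡ 3
    block-row-degree =
      count-exactly uniq (compress-refl X ∷ linked n₁ Bs.fst∈X ∷ linked n₂ Bs.snd∈X ∷ []) covers

  compress-row-degree : Cubic A → ¬ DoublyLinked P → ∀ X → count (compress P X) ≡ 3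
  compress-row-degree (rows , cols) unlinked X =
    block-row-degree cols unlinked (blacksOf X) (outsideNeighbour rows _) (outsideNeighbour rows _)

-- Transposition

transpose : ∀ {n} → Matrix n → Matrix n
transpose A w b = A b w

module _ {n m : ℕ} {A : Matrix n} (P : K22Partition A m) where

  open K22Partition P

  transposePartition : K22Partition (transpose A) m
  transposePartition = record
    { blackBlock = whiteBlock ; whiteBlock = blackBlock
    ; twoBlack   = twoWhite   ; twoWhite   = twoBlack
    ; complete   = λ w b w∼b → complete b w (sym w∼b) }

  private
    module Kᵀ = K22Blocks transposePartition
    module K  = K22Blocks P

  transpose-doublyLinked : DoublyLinked transposePartition → DoublyLinked P
  transpose-doublyLinked d = record
    { b₁ = w₁ ; b₂ = w₂ ; w₁ = b₁ ; w₂ = b₂ ; b₁≢b₂ = w₁≢w₂ ; w₁≢w₂ = b₁≢b₂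
    ; same-black-block = same-white-block ; same-white-block = same-black-block
    ; distinct-blocks = ≢-sym distinct-blocks ; edge₁ = edge₁ ; edge₂ = edge₂ }
    where open DoublyLinked d

  compress-transpose : ∀ X Y → compress transposePartition X Y ≡ compress P Y X
  compress-transpose X Y = ⇔→≡ {z = true} (mk⇔ to from)
    where
    to : compress transposePartition X Y ≡ true → compress P Y X ≡ true
    to e with Kᵀ.compress-elim e
    ... | inj₁ refl                       = K.compress-refl X
    ... | inj₂ (w , b , refl , refl , bw) = K.compress-edge bw
    from : compress P Y X ≡ true → compress transposePartition X Y ≡ true
    from e with K.compress-elim e
    ... | inj₁ refl                       = Kᵀ.compress-refl Y
    ... | inj₂ (b , w , refl , refl , bw) = Kᵀ.compress-edge bw

compress-cubic : ∀ {n m} {A : Matrix n} → Cubic A → (P : K22Partition A m) → ¬ DoublyLinked P →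
                 Cubic (compress P)
compress-cubic cubic P unlinked =
  K22Blocks.compress-row-degree P cubic unlinked ,
  λ Y → trans (count-cong λ X → sym (compress-transpose P Y X))
              (K22Blocks.compress-row-degree (transposePartition P) (swap cubic)
                                             (unlinked ∘ transpose-doublyLinked P) Y)

-- Doubly linked blocks force n = 4

bits-cancel : ∀ {a b c d} → bit a + (bit b + (bit c + 0)) ≡ 1 → bit a + (bit b + (bit d + 0)) ≡ 1 →
              c ≡ d
bits-cancel {a} {b} {c} {d} e₁ e₂ =
  bit-injective (+0-cancel (+-cancelˡ-≡ (bit b) _ _ (+-cancelˡ-≡ (bit a) _ _ (trans e₁ (sym e₂)))))
  where
  +0-cancel : bit c + 0 ≡ bit d + 0 → bit c ≡ bit d
  +0-cancel e = trans (sym (+-identityʳ _)) (trans e (+-identityʳ _))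

double-bit : ∀ {r t} → bit r + (bit r + (bit t + 0)) ≡ 1 → t ≡ true
double-bit {false} {true} _ = refl

two-bits : ∀ {a b} c → a ≡ true → b ≡ true → bit a + (bit b + c) ≢ 1
two-bits c refl refl ()

three-of-four : ∀ a b c d → bit a + (bit b + (bit c + (bit d + 0))) ≡ 3 → a ≡ true ⊎ b ≡ true
three-of-four true  _     _     _     _  = inj₁ refl
three-of-four false true  _     _     _  = inj₂ refl
three-of-four false false true  true  ()
three-of-four false false true  false ()
three-of-four false false false true  ()
three-of-four false false false false ()

module _ {n : ℕ} {A : Matrix n} (negativeLehman : NegativeLehman A) where

  private
    B : Matrix n
    B = proj₁ negativeLehman

  lehman-on-neighbourhood : ∀ {i} {ks : List (Fin n)} → Unique ks → All (λ k → A i k ≡ true) ks →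
    count (A i) ≡ length ks → ∀ j → sum (map (bit ∘ B j) ks) ≡ (if i == j then 0 else 1)
  lehman-on-neighbourhood {i} uniq true-on c j =
    trans (sym (count-∧ uniq true-on c (B j))) (proj₂ negativeLehman i j)

  lehman-diag : ∀ i k → A i k ∧ B i k ≡ false
  lehman-diag i =
    count≡0⇒false (trans (proj₂ negativeLehman i i) (cong (λ b → if b then 0 else 1) (==-refl i)))

  off-diagonal : ∀ {i j : Fin n} → i ≢ j → (if i == j then 0 else 1) ≡ 1
  off-diagonal i≢j = cong (λ b → if b then 0 else 1) (≢⇒== i≢j)

  module _ {m : ℕ} (cubic : Cubic A) (P : K22Partition A m) where

    private
      rows : ∀ b → count (A b) ≡ 3
      rows = proj₁ cubic
      cols : ∀ w → count (λ b → A b w) ≡ 3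
      cols = proj₂ cubic

    open K22Partition P
    open K22Blocks P using (blacksOf; whitesOf; OutsideNeighbour; outsideNeighbour)

    module DoublyLinkedBlocks (d : DoublyLinked P)
             (whitesOfX : BlockPair whiteBlock (blackBlock (DoublyLinked.b₁ d)))
             (blacksOfY : BlockPair blackBlock (whiteBlock (DoublyLinked.w₁ d)))
             (out₁ : OutsideNeighbour (BlockPair.fst blacksOfY))
             (out₂ : OutsideNeighbour (BlockPair.snd blacksOfY)) where

      open DoublyLinked d
      open BlockPair whitesOfX using ()
        renaming (fst to x₁; snd to x₂; fst≢snd to x₁≢x₂; fst∈X to x₁∈X; snd∈X to x₂∈X)
      open BlockPair blacksOfY using ()
        renaming (fst to y₁; snd to y₂; fst≢snd to y₁≢y₂; fst∈X to y₁∈Y; snd∈X to y₂∈Y)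
      open OutsideNeighbour out₁ using () renaming (vertex to z₁; edge to y₁z₁; outside to z₁∉Y)
      open OutsideNeighbour out₂ using () renaming (vertex to z₂; edge to y₂z₂; outside to z₂∉Y)

      private
        blacks : List (Fin n)
        blacks = b₁ ∷ b₂ ∷ y₁ ∷ y₂ ∷ []

        uniq-blacks : Unique blacks
        uniq-blacks =
          unique-across-blocks distinct-blocks b₁≢b₂ y₁≢y₂ refl (sym same-black-block) y₁∈Y y₂∈Y

        ∉-whitesOf-Y : ∀ {z} → whiteBlock z ≢ whiteBlock w₁ → z ∉ w₁ ∷ w₂ ∷ []
        ∉-whitesOf-Y z∉Y (here refl)         = z∉Y refl
        ∉-whitesOf-Y z∉Y (there (here refl)) = z∉Y (sym same-white-block)

        ∉-whitesOf-X : ∀ {w} → whiteBlock w ≡ whiteBlock w₁ → w ∉ x₁ ∷ x₂ ∷ []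
        ∉-whitesOf-X w∈Y (here refl)         = distinct-blocks (trans (sym x₁∈X) w∈Y)
        ∉-whitesOf-X w∈Y (there (here refl)) = distinct-blocks (trans (sym x₂∈X) w∈Y)

        in-block : ∀ {b w Z} → blackBlock b ≡ Z → whiteBlock w ≡ Z → A b w ≡ true
        in-block b∈Z w∈Z = complete _ _ (trans b∈Z (sym w∈Z))

        z₁∉w : z₁ ∉ w₁ ∷ w₂ ∷ []
        z₁∉w = ∉-whitesOf-Y (subst (whiteBlock z₁ ≢_) y₁∈Y z₁∉Y)

        z₂∉w : z₂ ∉ w₁ ∷ w₂ ∷ []
        z₂∉w = ∉-whitesOf-Y (subst (whiteBlock z₂ ≢_) y₂∈Y z₂∉Y)

        uniq-b₁ : Unique (x₁ ∷ x₂ ∷ w₁ ∷ [])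
        uniq-b₁ = unique-snoc₂ x₁≢x₂ (∉-whitesOf-X refl)

        uniq-b₂ : Unique (x₁ ∷ x₂ ∷ w₂ ∷ [])
        uniq-b₂ = unique-snoc₂ x₁≢x₂ (∉-whitesOf-X (sym same-white-block))

        adj-b₁ : All (λ w → A b₁ w ≡ true) (x₁ ∷ x₂ ∷ w₁ ∷ [])
        adj-b₁ = in-block refl x₁∈X ∷ in-block refl x₂∈X ∷ edge₁ ∷ []

        adj-b₂ : All (λ w → A b₂ w ≡ true) (x₁ ∷ x₂ ∷ w₂ ∷ [])
        adj-b₂ =
          in-block (sym same-black-block) x₁∈X ∷ in-block (sym same-black-block) x₂∈X ∷ edge₂ ∷ []

        row-b₁ : ∀ {j} → j ∉ blacks → bit (B j x₁) + (bit (B j x₂) + (bit (B j w₁) + 0)) ≡ 1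
        row-b₁ {j} j∉ = trans (lehman-on-neighbourhood uniq-b₁ adj-b₁ (rows b₁) j)
                              (off-diagonal (j∉ ∘ here ∘ sym))

        row-b₂ : ∀ {j} → j ∉ blacks → bit (B j x₁) + (bit (B j x₂) + (bit (B j w₂) + 0)) ≡ 1
        row-b₂ {j} j∉ = trans (lehman-on-neighbourhood uniq-b₂ adj-b₂ (rows b₂) j)
                              (off-diagonal (j∉ ∘ there ∘ here ∘ sym))

        row-y : ∀ {y z} → blackBlock y ≡ whiteBlock w₁ → A y z ≡ true → z ∉ w₁ ∷ w₂ ∷ [] →
                ∀ j → bit (B j w₁) + (bit (B j w₂) + (bit (B j z) + 0)) ≡ (if y == j then 0 else 1)
        row-y {y} y∈Y yz z∉w =
          lehman-on-neighbourhood (unique-snoc₂ w₁≢w₂ z∉w)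
            (in-block y∈Y refl ∷ in-block y∈Y (sym same-white-block) ∷ yz ∷ []) (rows y)

        forced : ∀ {j y z} → j ∉ blacks → y ∈ blacks → blackBlock y ≡ whiteBlock w₁ →
                 A y z ≡ true → z ∉ w₁ ∷ w₂ ∷ [] → B j z ≡ true
        forced {j} {y} {z} j∉ y∈ y∈Y yz z∉w =
          double-bit {B j w₂} (subst (λ t → bit t + (bit (B j w₂) + (bit (B j z) + 0)) ≡ 1)
                            (bits-cancel {B j x₁} {B j x₂} (row-b₁ j∉) (row-b₂ j∉))
                            (trans (row-y y∈Y yz z∉w j) (off-diagonal λ { refl → j∉ y∈ })))

        forced-z₁ : ∀ {j} → j ∉ blacks → B j z₁ ≡ true
        forced-z₁ j∉ = forced j∉ (there (there (here refl))) y₁∈Y y₁z₁ z₁∉w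

        forced-z₂ : ∀ {j} → j ∉ blacks → B j z₂ ≡ true
        forced-z₂ j∉ = forced j∉ (there (there (there (here refl)))) y₂∈Y y₂z₂ z₂∉w

        column-in-blacks : ∀ {z} → (∀ {j} → j ∉ blacks → B j z ≡ true) →
                           ∀ {i} → A i z ≡ true → i ∈ blacks
        column-in-blacks {z} forced-z {i} iz with any? (i ≟_) blacks
        ... | yes i∈ = i∈
        ... | no  i∉ = contradiction (trans (sym (lehman-diag i z)) (∧-intro iz (forced-z i∉))) λ ()

        drop : ∀ {z w} → z ∉ w₁ ∷ w₂ ∷ [] → w ∈ w₁ ∷ w₂ ∷ [] →
               z ∈ x₁ ∷ x₂ ∷ w ∷ [] → z ∈ x₁ ∷ x₂ ∷ []
        drop _   _   (here z≡x₁)                 = here z≡x₁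
        drop _   _   (there (here z≡x₂))         = there (here z≡x₂)
        drop z∉w w∈w (there (there (here refl))) = contradiction w∈w z∉w

        in-square : ∀ {z} → (∀ {j} → j ∉ blacks → B j z ≡ true) → z ∉ w₁ ∷ w₂ ∷ [] →
                    z ∈ x₁ ∷ x₂ ∷ []
        in-square {z} forced-z z∉w
          with three-of-four (A b₁ z) (A b₂ z) (A y₁ z) (A y₂ z)
                 (trans (sym (count-over (λ i → A i z) uniq-blacks (column-in-blacks forced-z))) (cols z))
        ... | inj₁ b₁z = drop z∉w (here refl)         (count≡length⇒⊆ uniq-b₁ adj-b₁ (rows b₁) b₁z)
        ... | inj₂ b₂z = drop z∉w (there (here refl)) (count≡length⇒⊆ uniq-b₂ adj-b₂ (rows b₂) b₂z)

        z₁≢z₂ : z₁ ≢ z₂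
        z₁≢z₂ z₁≡z₂ = contradiction (trans (sym (subst S z₁≡z₂ diagonal)) off) λ ()
          where
          S : Fin n → Set
          S z = bit (B y₁ w₁) + (bit (B y₁ w₂) + (bit (B y₁ z) + 0)) ≡ 0
          diagonal : S z₁
          diagonal =
            trans (row-y y₁∈Y y₁z₁ z₁∉w y₁) (cong (λ b → if b then 0 else 1) (==-refl y₁))
          off : bit (B y₁ w₁) + (bit (B y₁ w₂) + (bit (B y₁ z₂) + 0)) ≡ 1
          off = trans (row-y y₂∈Y y₂z₂ z₂∉w y₁) (off-diagonal (y₁≢y₂ ∘ sym))

        nothing-outside : ∀ {j} → j ∉ blacks → ⊥
        nothing-outside {j} j∉ = two-bits _ (proj₁ Bx) (proj₂ Bx) (row-b₁ j∉)
          where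
          Bx : B j x₁ ≡ true × B j x₂ ≡ true
          Bx = pair-exhausted {P = λ x → B j x ≡ true} z₁≢z₂
                 (in-square forced-z₁ z₁∉w) (in-square forced-z₂ z₂∉w) (forced-z₁ j∉) (forced-z₂ j∉)

        all-in-blacks : ∀ j → j ∈ blacks
        all-in-blacks j with any? (j ≟_) blacks
        ... | yes j∈ = j∈
        ... | no  j∉ = ⊥-elim (nothing-outside j∉)

      order≡4 : n ≡ 4
      order≡4 = trans (sym count-true)
                      (count-exactly uniq-blacks (refl ∷ refl ∷ refl ∷ refl ∷ []) (λ _ → all-in-blacks _))

    doublyLinked⇒order≡4 : DoublyLinked P → n ≡ 4
    doublyLinked⇒order≡4 d =
      DoublyLinkedBlocks.order≡4 d (whitesOf _) (blacksOf _)
                                   (outsideNeighbour rows _) (outsideNeighbour rows _)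

-- Recognising K₄,₄ minus a perfect matching

offDiagonal : ∀ {n} → Matrix n
offDiagonal i j = if i == j then false else true

module _ {n : ℕ} (A : Matrix n)
         (row-zero : ∀ b → count (not ∘ A b) ≡ 1)
         (column-zero : ∀ w → count (λ b → not (A b w)) ≡ 1) where

  private
    row : ∀ b → ∃ λ w → not (A b w) ≡ true × ∀ {k} → not (A b k) ≡ true → k ≡ w
    row b = count≡1⇒unique (not ∘ A b) (row-zero b)
    column : ∀ w → ∃ λ b → not (A b w) ≡ true × ∀ {k} → not (A k w) ≡ true → k ≡ b
    column w = count≡1⇒unique (λ b → not (A b w)) (column-zero w)

    σ : Fin n → Fin n
    σ b = proj₁ (row b)
    σ-zero : ∀ b → A b (σ b) ≡ false
    σ-zero b = not-injective (proj₁ (proj₂ (row b)))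
    σ-unique : ∀ {b w} → A b w ≡ false → w ≡ σ b
    σ-unique {b} e = proj₂ (proj₂ (row b)) (cong not e)

    τ : Fin n → Fin n
    τ w = proj₁ (column w)
    τ-zero : ∀ w → A (τ w) w ≡ false
    τ-zero w = not-injective (proj₁ (proj₂ (column w)))
    τ-unique : ∀ {b w} → A b w ≡ false → b ≡ τ w
    τ-unique {w = w} e = proj₂ (proj₂ (column w)) (cong not e)

    to : Vertex n → Vertex n
    to (inj₁ b) = inj₁ b
    to (inj₂ w) = inj₂ (τ w)

    from : Vertex n → Vertex n
    from (inj₁ b) = inj₁ b
    from (inj₂ w) = inj₂ (σ w)

    to-from : ∀ v → to (from v) ≡ v
    to-from (inj₁ b) = refl
    to-from (inj₂ w) = cong inj₂ (sym (τ-unique (σ-zero w)))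

    from-to : ∀ v → from (to v) ≡ v
    from-to (inj₁ b) = refl
    from-to (inj₂ w) = cong inj₂ (sym (σ-unique (τ-zero w)))

    offDiagonal-τ : ∀ b w → offDiagonal b (τ w) ≡ A b w
    offDiagonal-τ b w with b ≟ τ w
    ... | yes refl = sym (τ-zero w)
    ... | no  b≢τw with A b w in e
    ...   | true  = refl
    ...   | false = contradiction (τ-unique e) b≢τw

    adj-to : ∀ u v → adj offDiagonal (to u) (to v) ≡ adj A u v
    adj-to (inj₁ b) (inj₁ _) = refl
    adj-to (inj₁ b) (inj₂ w) = offDiagonal-τ b w
    adj-to (inj₂ w) (inj₁ b) = offDiagonal-τ b w
    adj-to (inj₂ w) (inj₂ _) = refl

  one-zero-per-line⇒≅offDiagonal : Isomorphic A offDiagonal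
  one-zero-per-line⇒≅offDiagonal = mk↔ₛ′ to from to-from from-to , adj-to

cubic⇒≅K44minusM : ∀ {n} → n ≡ 4 → (A : Matrix n) → Cubic A → Isomorphic A K44minusM
cubic⇒≅K44minusM refl A (rows , cols) =
  one-zero-per-line⇒≅offDiagonal A (λ b → one-zero (A b) (rows b))
                                   (λ w → one-zero (λ b → A b w) (cols w))
  where
  one-zero : (p : Fin 4 → Bool) → count p ≡ 3 → count (not ∘ p) ≡ 1
  one-zero p c = +-cancelˡ-≡ 3 _ _ (trans (cong (_+ count (not ∘ p)) (sym c)) (count-not p))

proposition4p3 : {n m : ℕ} (A : Matrix n) → CubicNegativeLehman A →
    (P : K22Partition A m) → ¬ Isomorphic A K44minusM → Cubic (compress P)
proposition4p3 A (cubic , negativeLehman) P ¬A≅K44minusM = compress-cubic cubic P unlinked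
  where
  unlinked : ¬ DoublyLinked P
  unlinked linked =
    ¬A≅K44minusM (cubic⇒≅K44minusM (doublyLinked⇒order≡4 negativeLehman cubic P linked) A cubic)
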